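{- If $I = (I_1,I_2,I_3) \in \{0,1\}^3$ satisfies $I_2 \neq I_3$, then $L(n,I) \geq 2^{n-2}$ for every $n \in \mathbb{N}$.
   Context: For $n \in \mathbb{N}$ and $I=(I_1,I_2,I_3) \in \{0,1\}^3$, $M_I^{(n)}$ is the tournament on $\{x_1,\ldots,x_{2n}\} \cup \{y_1,\ldots,y_n\}$ with: (i) $x_i \to x_j$ for $i<j$; (ii) $x_{2i} \to y_i \to x_{2i-1}$ for each $i \in [n]$; (iii) for $i<j$, $y_i \to y_j$ iff $I_1=1$; (iv) for $i \le 2j-2$, $x_i \to y_j$ iff $I_2 = 1$; (v) for $i \ge 2j+1$, $y_j \to x_i$ iff $I_3 = 1$. $L(n,I)$ is the number of pairwise non-isomorphic $n$-vertex tournaments that are isomorphic to an induced sub-tournament of $M_I^{(m)}$ for some (equivalently all sufficiently large) $m$. -}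

module Defs where

open import Data.Bool using (Bool; true; false; not; if_then_else_)
open import Data.Nat using (ℕ; suc; _*_; _∸_; _≡ᵇ_; _<ᵇ_; _≤ᵇ_)
open import Data.Fin using (Fin; toℕ)
open import Data.Product using (Σ; ∃; _×_)
open import Function.Bundles using (_↔_; Inverse)
open import Function.Definitions using (Injective)
open import Relation.Binary.PropositionalEquality using (_≡_; _≢_)
open import Relation.Nullary using (¬_)

-- A tournament on the vertex set Fin n: adj u v ≡ true means the arc u → v.
record Tournament (n : ℕ) : Set where
  field
    adj    : Fin n → Fin n → Bool
    irrefl : ∀ v → adj v v ≡ false
    tourn  : ∀ u v → u ≢ v → adj u v ≡ not (adj v u)
open Tournament public

Iso : {n : ℕ} → Tournament n → Tournament n → Set
Iso {n} S T = Σ (Fin n ↔ Fin n) λ σ →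
  ∀ u v → adj T (Inverse.to σ u) (Inverse.to σ v) ≡ adj S u v

-- Vertices of M_I^(m): x a stands for x_{a+1} (a < 2m), y b for y_{b+1} (b < m).
data Vert (m : ℕ) : Set where
  x : Fin (2 * m) → Vert m
  y : Fin m → Vert m

-- Arc x_i → y_j in M_I^(m), with 1-based indices i, j (rules (ii), (iv), (v)).
xy : Bool → Bool → ℕ → ℕ → Bool
xy I₂ I₃ i j =
  if i ≡ᵇ (2 * j) then true
  else if i ≡ᵇ (2 * j ∸ 1) then false
  else if i ≤ᵇ (2 * j ∸ 2) then I₂
  else not I₃

M : Bool → Bool → Bool → (m : ℕ) → Vert m → Vert m → Bool
M I₁ I₂ I₃ m (x a) (x a') = suc (toℕ a) <ᵇ suc (toℕ a')
M I₁ I₂ I₃ m (x a) (y b)  = xy I₂ I₃ (suc (toℕ a)) (suc (toℕ b))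
M I₁ I₂ I₃ m (y b) (x a)  = not (xy I₂ I₃ (suc (toℕ a)) (suc (toℕ b)))
M I₁ I₂ I₃ m (y b) (y b') =
  if suc (toℕ b) <ᵇ suc (toℕ b') then I₁
  else if suc (toℕ b') <ᵇ suc (toℕ b) then not I₁
  else false

Embeds : Bool → Bool → Bool → {n : ℕ} → Tournament n → Set
Embeds I₁ I₂ I₃ {n} T = ∃ λ m → Σ (Fin n → Vert m) λ f →
  Injective _≡_ _≡_ f × (∀ u v → adj T u v ≡ M I₁ I₂ I₃ m (f u) (f v))

L≥ : Bool → Bool → Bool → ℕ → ℕ → Set
L≥ I₁ I₂ I₃ n K = Σ (Fin K → Tournament n) λ T →
  (∀ k → Embeds I₁ I₂ I₃ (T k)) ×
  (∀ k l → k ≢ l → ¬ Iso (T k) (T l))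

-- When I₂ ≠ I₃, all arcs between the x's and the y's point the same way, except that y_j beats x_{2j-1}
-- if I₂ = 1 and loses to x_{2j} if I₂ = 0.  So an induced subtournament is a transitive top chain above a
-- transitive bottom chain, all arcs between them pointing down except along a monotone matching.  Read from
-- the top, its score sequence is that of the transitive tournament, lowered by one at matched top vertices
-- and raised by one at matched bottom vertices; grouping x_{2t+1}, x_{2t+2}, y_{t+1} into slot t realises
-- every such pattern, whichever way I₁ orients the y's.  Building patterns from the empty one by adding an
-- unmatched top vertex, an unmatched bottom vertex, or a matched pair around everything gives 2^(n-2)
-- patterns with non-increasing, pairwise different score sequences, and a non-increasing score sequence
-- is an isomorphism invariant.

module Submission where

open import Defs
open import Data.Bool using (Bool; true; false; not; if_then_else_)
open import Data.Bool.Properties using (not-involutive; ¬-not; not-¬; T-≡)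
open import Data.Empty using (⊥-elim)
open import Data.Fin using (Fin; zero; suc; toℕ; fromℕ<)
import Data.Fin.Properties as Fin
open import Data.List using (List; []; _∷_; _++_; _∷ʳ_; [_]; map; length; reverse; downFrom; zipWith; head)
open import Data.List.Properties
  using (map-++; map-∘; map-cong; map-cong-local; map-injective; length-++; length-map; ++-assoc;
         ∷-injectiveʳ; ∷ʳ-injectiveˡ; ∷ʳ-injectiveʳ; reverse-map; reverse-involutive; length-reverse; unfold-reverse)
open import Data.List.Relation.Unary.All as All using (All; []; _∷_)
open import Data.List.Relation.Unary.AllPairs as AllPairs using (AllPairs; []; _∷_)
import Data.List.Relation.Unary.AllPairs.Properties as AllPairsₚ
open import Data.List.Relation.Unary.All.Properties using () renaming (++⁺ to All-++⁺; map⁺ to All-map⁺)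
open import Data.List.Relation.Binary.Permutation.Propositional.Properties using (↭-reverse)
open import Data.Maybe using (just)
import Data.Maybe as Maybe
open import Data.Maybe.Properties using (just-injective)
open import Data.Nat
open import Data.Nat.ListAction using (sum)
open import Data.Nat.ListAction.Properties using (sum-++; sum-↭)
open import Data.Nat.Properties
open import Algebra.Properties.CommutativeMonoid.Sum +-0-commutativeMonoid
  using (sum-permute; sum-cong-≗; sum-syntax) renaming (sum to ∑)
open import Data.Product using (Σ; _×_; _,_; proj₁; proj₂)
open import Data.Sum using (inj₁; inj₂)
import Data.Product as Product
open import Function using (_∘_; flip)
open import Function.Bundles using (Equivalence; Inverse; _⇔_; mk⇔)
open import Function.Definitions using (Injective)
open import Relation.Binary.PropositionalEquality hiding ([_])
open import Relation.Unary using (_⊆_)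
open import Relation.Nullary using (¬_; yes; no)
open import Relation.Binary.Definitions using (tri<; tri≈; tri>)

≡ᵇ-refl : ∀ n → (n ≡ᵇ n) ≡ true
≡ᵇ-refl n = Equivalence.to T-≡ (≡⇒≡ᵇ n n refl)

≢⇒≡ᵇ-false : ∀ {m n} → m ≢ n → (m ≡ᵇ n) ≡ false
≢⇒≡ᵇ-false {m} {n} m≢n = ¬-not (m≢n ∘ ≡ᵇ⇒≡ m n ∘ Equivalence.from T-≡)

<⇒<ᵇ-true : ∀ {m n} → m < n → (m <ᵇ n) ≡ true
<⇒<ᵇ-true m<n = Equivalence.to T-≡ (<⇒<ᵇ m<n)

≤⇒<ᵇ-false : ∀ {m n} → n ≤ m → (m <ᵇ n) ≡ false
≤⇒<ᵇ-false {m} {n} n≤m = ¬-not (≤⇒≯ n≤m ∘ <ᵇ⇒< m n ∘ Equivalence.from T-≡)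

≰⇒≤ᵇ-false : ∀ {m n} → ¬ m ≤ n → (m ≤ᵇ n) ≡ false
≰⇒≤ᵇ-false {m} {n} m≰n = ¬-not (m≰n ∘ ≤ᵇ⇒≤ m n ∘ Equivalence.from T-≡)

≤⇒≤ᵇ-true : ∀ {m n} → m ≤ n → (m ≤ᵇ n) ≡ true
≤⇒≤ᵇ-true m≤n = Equivalence.to T-≡ (≤⇒≤ᵇ m≤n)

boolToℕ : Bool → ℕ
boolToℕ false = 0
boolToℕ true  = 1

orient : ∀ {A : Set} → Bool → List A → List A
orient true  L = L
orient false L = reverse L

module _ {A : Set} where

  orient-involutive : ∀ τ (L : List A) → orient τ (orient τ L) ≡ L
  orient-involutive true  L = refl
  orient-involutive false L = reverse-involutive L

  length-orient : ∀ τ (L : List A) → length (orient τ L) ≡ length L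
  length-orient true  L = refl
  length-orient false L = length-reverse L

  map-orient : ∀ {B : Set} τ (f : A → B) L → map f (orient τ L) ≡ orient τ (map f L)
  map-orient true  f L = refl
  map-orient false f L = reverse-map f L

  All-reverse : ∀ {P : A → Set} {L} → All P L → All P (reverse L)
  All-reverse {L = []} [] = []
  All-reverse {P = P} {L = a ∷ L} (p ∷ ps) =
    subst (All P) (sym (unfold-reverse a L)) (All-++⁺ (All-reverse ps) (p ∷ []))

  All-orient : ∀ {P : A → Set} τ {L} → All P L → All P (orient τ L)
  All-orient true  ps = ps
  All-orient false ps = All-reverse ps

  AllPairs-reverse : ∀ {R : A → A → Set} {L} → AllPairs R L → AllPairs (flip R) (reverse L)
  AllPairs-reverse {L = []} [] = []
  AllPairs-reverse {R = R} {L = a ∷ L} (p ∷ ps) =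
    subst (AllPairs (flip R)) (sym (unfold-reverse a L))
      (AllPairsₚ.++⁺ (AllPairs-reverse ps) ([] ∷ []) (All-reverse (All.map (_∷ []) p)))

sum-orient : ∀ τ L → sum (orient τ L) ≡ sum L
sum-orient true  L = refl
sum-orient false L = sum-↭ (↭-reverse L)

map-+ : ∀ {A : Set} (f g : A → ℕ) L → map (λ a → f a + g a) L ≡ zipWith _+_ (map f L) (map g L)
map-+ f g []      = refl
map-+ f g (a ∷ L) = cong (f a + g a ∷_) (map-+ f g L)

Arc : ∀ {A : Set} → (A → A → Bool) → Bool → A → A → Set
Arc R τ a b = (R a b ≡ τ) × (R b a ≡ not τ)

module Scores {A : Set} (R : A → A → Bool) where

  scoreIn : A → List A → ℕ
  scoreIn a L = sum (map (λ b → boolToℕ (R a b)) L)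

  scoreIn-++ : ∀ a L L' → scoreIn a (L ++ L') ≡ scoreIn a L + scoreIn a L'
  scoreIn-++ a L L' = trans (cong sum (map-++ _ L L')) (sum-++ (map _ L) _)

  scoreIn-orient : ∀ τ a L → scoreIn a (orient τ L) ≡ scoreIn a L
  scoreIn-orient τ a L = trans (cong sum (map-orient τ _ L)) (sum-orient τ _)

  scoreIn-all : ∀ a L → All (λ b → R a b ≡ true) L → scoreIn a L ≡ length L
  scoreIn-all a [] [] = refl
  scoreIn-all a (b ∷ L) (p ∷ ps) rewrite p = cong suc (scoreIn-all a L ps)

  scoreIn-none : ∀ a L → All (λ b → R a b ≡ false) L → scoreIn a L ≡ 0
  scoreIn-none a [] [] = refl
  scoreIn-none a (b ∷ L) (p ∷ ps) rewrite p = scoreIn-none a L ps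

  transitive-scores : (∀ a → R a a ≡ false) → ∀ {L} → AllPairs (Arc R true) L →
    map (λ a → scoreIn a L) L ≡ downFrom (length L)
  transitive-scores irrefl {[]} [] = refl
  transitive-scores irrefl {a ∷ L} (a→L ∷ chain) = cong₂ _∷_
    (trans (cong (λ r → boolToℕ r + scoreIn a L) (irrefl a)) (scoreIn-all a L (All.map proj₁ a→L)))
    (trans (map-cong-local (All.map (λ arc → cong (λ r → boolToℕ r + scoreIn _ L) (proj₂ arc)) a→L))
      (transitive-scores irrefl chain))

  scores-∷ : ∀ τ b B {L} → All (λ a → R a b ≡ τ) L →
    map (λ a → scoreIn a (b ∷ B)) L ≡ map (λ a → boolToℕ τ + scoreIn a B) L
  scores-∷ τ b B = map-cong-local ∘ All.map (cong λ r → boolToℕ r + scoreIn _ B)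

  scores-orient : ∀ τ τ' L L' →
    map (λ a → scoreIn a (orient τ' L')) (orient τ L) ≡ orient τ (map (λ a → scoreIn a L') L)
  scores-orient τ τ' L L' =
    trans (map-cong (λ a → scoreIn-orient τ' a L') (orient τ L)) (map-orient τ _ L)

  AllPairs-orient : ∀ τ {L} → AllPairs (Arc R τ) L → AllPairs (Arc R true) (orient τ L)
  AllPairs-orient true  chain = chain
  AllPairs-orient false chain = AllPairs-reverse (AllPairs.map (λ (p , q) → q , p) chain)

-- Score sequences of tournaments

score : ∀ {n} → Tournament n → Fin n → ℕ
score {n} T u = ∑[ v < n ] boolToℕ (adj T u v)

score-iso : ∀ {n} {S T : Tournament n} ((σ , σ-hom) : Iso S T) u → score T (Inverse.to σ u) ≡ score S u
score-iso (σ , σ-hom) u = trans (sum-permute _ σ) (sum-cong-≗ (cong boolToℕ ∘ σ-hom u))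

atLeast : ∀ {n} → ℕ → (Fin n → ℕ) → ℕ
atLeast {n} t a = ∑[ i < n ] boolToℕ (t ≤ᵇ a i)

atLeast-iso : ∀ {n} {S T : Tournament n} → Iso S T → ∀ t → atLeast t (score T) ≡ atLeast t (score S)
atLeast-iso {S = S} {T} iso@(σ , _) t =
  trans (sum-permute _ σ) (sum-cong-≗ (cong (boolToℕ ∘ (t ≤ᵇ_)) ∘ score-iso {S = S} {T} iso))

NonIncreasing : ∀ {n} → (Fin n → ℕ) → Set
NonIncreasing a = ∀ {i j} → toℕ i ≤ toℕ j → a j ≤ a i

atLeast-none : ∀ {n} t (a : Fin n → ℕ) → (∀ i → a i < t) → atLeast t a ≡ 0
atLeast-none {zero}  t a a<t = refl
atLeast-none {suc n} t a a<t rewrite ≰⇒≤ᵇ-false (<⇒≱ (a<t zero)) =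
  atLeast-none t (a ∘ suc) (a<t ∘ suc)

atLeast-initial : ∀ {n} (a : Fin n → ℕ) → NonIncreasing a →
  ∀ t i → t ≤ a i ⇔ toℕ i < atLeast t a
atLeast-initial {suc n} a a↘ t i with t ≤? a zero
... | yes t≤a₀ rewrite ≤⇒≤ᵇ-true t≤a₀ = lemma i
  where
  lemma : ∀ i → t ≤ a i ⇔ toℕ i < suc (atLeast t (a ∘ suc))
  lemma zero    = mk⇔ (λ _ → z<s) (λ _ → t≤a₀)
  lemma (suc i) = mk⇔ (s≤s ∘ Equivalence.to rec) (Equivalence.from rec ∘ s≤s⁻¹)
    where rec = atLeast-initial (a ∘ suc) (λ i≤j → a↘ (s≤s i≤j)) t i
... | no t≰a₀ rewrite ≰⇒≤ᵇ-false t≰a₀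
                   | atLeast-none t (a ∘ suc) (λ j → ≤-<-trans (a↘ z≤n) (≰⇒> t≰a₀)) =
  mk⇔ (λ t≤aᵢ → ⊥-elim (t≰a₀ (≤-trans t≤aᵢ (a↘ z≤n)))) λ ()

nonIncreasing-unique : ∀ {n} {a b : Fin n → ℕ} → NonIncreasing a → NonIncreasing b →
  (∀ t → atLeast t a ≡ atLeast t b) → ∀ i → a i ≡ b i
nonIncreasing-unique a↘ b↘ same i = ≤-antisym (below a↘ b↘ same i) (below b↘ a↘ (sym ∘ same) i)
  where
  below : ∀ {n} {a b : Fin n → ℕ} → NonIncreasing a → NonIncreasing b →
    (∀ t → atLeast t a ≡ atLeast t b) → ∀ i → a i ≤ b i
  below {a = a} {b} a↘ b↘ same i = Equivalence.from (atLeast-initial b b↘ (a i) i)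
    (subst (toℕ i <_) (same (a i)) (Equivalence.to (atLeast-initial a a↘ (a i) i) ≤-refl))

iso⇒equal-scores : ∀ {n} {S T : Tournament n} → Iso S T →
  NonIncreasing (score S) → NonIncreasing (score T) → ∀ i → score S i ≡ score T i
iso⇒equal-scores {S = S} {T} iso S↘ T↘ =
  nonIncreasing-unique S↘ T↘ (sym ∘ atLeast-iso {S = S} {T} iso)

at : ∀ {A : Set} {n} (L : List A) → .(length L ≡ n) → Fin n → A
at (a ∷ L) eq zero    = a
at (a ∷ L) eq (suc i) = at L (suc-injective eq) i

module _ {A : Set} where

  sum-at : ∀ {n} (L : List A) .(eq : length L ≡ n) (h : A → ℕ) →
    ∑[ i < n ] h (at L eq i) ≡ sum (map h L)
  sum-at {zero}  []      eq h = refl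
  sum-at {suc n} (a ∷ L) eq h = cong (h a +_) (sum-at L (suc-injective eq) h)

  at-map : ∀ {B : Set} {n} (f : A → B) L .(eq : length L ≡ n) .(eq' : length (map f L) ≡ n) →
    ∀ i → at (map f L) eq' i ≡ f (at L eq i)
  at-map f (a ∷ L) eq eq' zero    = refl
  at-map f (a ∷ L) eq eq' (suc i) = at-map f L (suc-injective eq) (suc-injective eq') i

  at-cong : ∀ {n} {L L' : List A} .{eq : length L ≡ n} .{eq' : length L' ≡ n} →
    L ≡ L' → ∀ i → at L eq i ≡ at L' eq' i
  at-cong refl i = refl

  at-ext : ∀ {n} (L L' : List A) .(eq : length L ≡ n) .(eq' : length L' ≡ n) →
    (∀ i → at L eq i ≡ at L' eq' i) → L ≡ L'
  at-ext {zero}  []      []       eq eq' same = refl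
  at-ext {suc n} (a ∷ L) (a' ∷ L') eq eq' same =
    cong₂ _∷_ (same zero) (at-ext L L' (suc-injective eq) (suc-injective eq') (same ∘ suc))

  at-All : ∀ {P : A → Set} {n} {L} .(eq : length L ≡ n) → All P L → ∀ i → P (at L eq i)
  at-All eq (p ∷ ps) zero    = p
  at-All eq (p ∷ ps) (suc i) = at-All (suc-injective eq) ps i

  at-AllPairs : ∀ {R : A → A → Set} {n} {L} .(eq : length L ≡ n) → AllPairs R L →
    ∀ {i j} → toℕ i < toℕ j → R (at L eq i) (at L eq j)
  at-AllPairs eq (r ∷ rs) {zero}  {suc j} _         = at-All (suc-injective eq) r j
  at-AllPairs eq (r ∷ rs) {suc i} {suc j} (s≤s i<j) = at-AllPairs (suc-injective eq) rs i<j

AllPairs-mapWith : ∀ {A : Set} {P : A → Set} {R S : A → A → Set} →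
  (∀ {a b} → P a → P b → R a b → S a b) → ∀ {L} → All P L → AllPairs R L → AllPairs S L
AllPairs-mapWith f []         []         = []
AllPairs-mapWith f (pa ∷ pas) (ra ∷ ras) =
  All.zipWith (λ (pb , r) → f pa pb r) (pas , ra) ∷ AllPairs-mapWith f pas ras

-- The tournament M_I

-- M_I on unbounded indices, so that arcs can be computed without carrying bound proofs.
data Vert∞ : Set where
  x∞ y∞ : ℕ → Vert∞

M∞ : Bool → Bool → Bool → Vert∞ → Vert∞ → Bool
M∞ I₁ I₂ I₃ (x∞ a) (x∞ a') = suc a <ᵇ suc a'
M∞ I₁ I₂ I₃ (x∞ a) (y∞ b)  = xy I₂ I₃ (suc a) (suc b)
M∞ I₁ I₂ I₃ (y∞ b) (x∞ a)  = not (xy I₂ I₃ (suc a) (suc b))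
M∞ I₁ I₂ I₃ (y∞ b) (y∞ b') =
  if suc b <ᵇ suc b' then I₁
  else if suc b' <ᵇ suc b then not I₁
  else false

unbound : ∀ {m} → Vert m → Vert∞
unbound (x a) = x∞ (toℕ a)
unbound (y b) = y∞ (toℕ b)

unbound-injective : ∀ {m} → Injective _≡_ _≡_ (unbound {m})
unbound-injective {x = x a} {x a'} eq = cong x (Fin.toℕ-injective (x∞-injective eq))
  where x∞-injective : ∀ {a a'} → x∞ a ≡ x∞ a' → a ≡ a'
        x∞-injective refl = refl
unbound-injective {x = y b} {y b'} eq = cong y (Fin.toℕ-injective (y∞-injective eq))
  where y∞-injective : ∀ {b b'} → y∞ b ≡ y∞ b' → b ≡ b'
        y∞-injective refl = refl

M≡M∞ : ∀ I₁ I₂ I₃ m (u v : Vert m) →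
  M I₁ I₂ I₃ m u v ≡ M∞ I₁ I₂ I₃ (unbound u) (unbound v)
M≡M∞ I₁ I₂ I₃ m (x a) (x a') = refl
M≡M∞ I₁ I₂ I₃ m (x a) (y b)  = refl
M≡M∞ I₁ I₂ I₃ m (y b) (x a)  = refl
M≡M∞ I₁ I₂ I₃ m (y b) (y b') = refl

M∞-irrefl : ∀ I₁ I₂ I₃ u → M∞ I₁ I₂ I₃ u u ≡ false
M∞-irrefl I₁ I₂ I₃ (x∞ a) = ≤⇒<ᵇ-false (≤-refl {a})
M∞-irrefl I₁ I₂ I₃ (y∞ b) rewrite ≤⇒<ᵇ-false (≤-refl {b}) = refl

M∞-flip : ∀ I₁ I₂ I₃ u v → u ≢ v → M∞ I₁ I₂ I₃ u v ≡ not (M∞ I₁ I₂ I₃ v u)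
M∞-flip I₁ I₂ I₃ (x∞ a) (y∞ b) _ = sym (not-involutive _)
M∞-flip I₁ I₂ I₃ (y∞ b) (x∞ a) _ = refl
M∞-flip I₁ I₂ I₃ (x∞ a) (x∞ a') u≢v with <-cmp a a'
... | tri< a<a' _ _ rewrite <⇒<ᵇ-true a<a' | ≤⇒<ᵇ-false (<⇒≤ a<a') = refl
... | tri≈ _ refl _ = ⊥-elim (u≢v refl)
... | tri> _ _ a>a' rewrite <⇒<ᵇ-true a>a' | ≤⇒<ᵇ-false (<⇒≤ a>a') = refl
M∞-flip I₁ I₂ I₃ (y∞ b) (y∞ b') u≢v with <-cmp b b'
... | tri< b<b' _ _ rewrite <⇒<ᵇ-true b<b' | ≤⇒<ᵇ-false (<⇒≤ b<b') = sym (not-involutive _)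
... | tri≈ _ refl _ = ⊥-elim (u≢v refl)
... | tri> _ _ b>b' rewrite <⇒<ᵇ-true b>b' | ≤⇒<ᵇ-false (<⇒≤ b>b') = refl

-- Slot t of M_I consists of x_{2t+1} = sx t false, x_{2t+2} = sx t true and y_{t+1} = sy t.
data Slotted : Set where
  sx : ℕ → Bool → Slotted
  sy : ℕ → Slotted

xIndex : ℕ → Bool → ℕ
xIndex t false = t + t
xIndex t true  = suc (t + t)

toVert∞ : Slotted → Vert∞
toVert∞ (sx t e) = x∞ (xIndex t e)
toVert∞ (sy t)   = y∞ t

slot : Slotted → ℕ
slot (sx t _) = t
slot (sy t)   = t

xIndex-≤ : ∀ t e → xIndex t e ≤ suc (t + t)
xIndex-≤ t false = n≤1+n _
xIndex-≤ t true  = ≤-refl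

xIndex-≥ : ∀ t e → t + t ≤ xIndex t e
xIndex-≥ t false = ≤-refl
xIndex-≥ t true  = n≤1+n _

double-< : ∀ {t t'} → t < t' → suc (suc (t + t)) ≤ t' + t'
double-< {t} {t'} t<t' = subst (_≤ t' + t') (cong suc (+-suc t t)) (+-mono-≤ t<t' t<t')

xIndex-< : ∀ {t t'} e e' → t < t' → xIndex t e < xIndex t' e'
xIndex-< {t} {t'} e e' t<t' =
  ≤-trans (s≤s (xIndex-≤ t e)) (≤-trans (double-< t<t') (xIndex-≥ t' e'))

xy-unfold : ∀ I₂ I₃ a s → xy I₂ I₃ (suc a) (suc s) ≡
  (if a ≡ᵇ suc (s + s) then true else if a ≡ᵇ s + s then false
   else if suc a ≤ᵇ s + s then I₂ else not I₃)
xy-unfold I₂ I₃ a s rewrite +-identityʳ s | +-suc s s = refl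

xy-below : ∀ I₂ I₃ {a s} → suc a ≤ s + s → xy I₂ I₃ (suc a) (suc s) ≡ I₂
xy-below I₂ I₃ {a} {s} a<2s rewrite xy-unfold I₂ I₃ a s
  | ≢⇒≡ᵇ-false (<⇒≢ (m<n⇒m<1+n a<2s)) | ≢⇒≡ᵇ-false (<⇒≢ a<2s)
  | ≤⇒≤ᵇ-true a<2s = refl

xy-above : ∀ I₂ I₃ {a s} → suc (suc (s + s)) ≤ a → xy I₂ I₃ (suc a) (suc s) ≡ not I₃
xy-above I₂ I₃ {a} {s} 2s+1<a rewrite xy-unfold I₂ I₃ a s
  | ≢⇒≡ᵇ-false (>⇒≢ 2s+1<a) | ≢⇒≡ᵇ-false (>⇒≢ (<-trans (n<1+n (s + s)) 2s+1<a))
  | ≤⇒<ᵇ-false {a} (<⇒≤ (<-trans (n<1+n (s + s)) 2s+1<a)) = refl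

xy-same : ∀ I₂ I₃ s e → xy I₂ I₃ (suc (xIndex s e)) (suc s) ≡ e
xy-same I₂ I₃ s false rewrite xy-unfold I₂ I₃ (s + s) s
  | ≢⇒≡ᵇ-false (<⇒≢ (n<1+n (s + s))) | ≡ᵇ-refl (s + s) = refl
xy-same I₂ I₃ s true rewrite xy-unfold I₂ I₃ (suc (s + s)) s | ≡ᵇ-refl (s + s) = refl

xy-earlier : ∀ I₂ I₃ {t s} e → t < s → xy I₂ I₃ (suc (xIndex t e)) (suc s) ≡ I₂
xy-earlier I₂ I₃ {t} e t<s = xy-below I₂ I₃ (≤-trans (s≤s (xIndex-≤ t e)) (double-< t<s))

xy-later : ∀ I₂ I₃ {t s} e → s < t → xy I₂ I₃ (suc (xIndex t e)) (suc s) ≡ not I₃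
xy-later I₂ I₃ {t} e s<t = xy-above I₂ I₃ (≤-trans (double-< s<t) (xIndex-≥ t e))

xIndex-bound : ∀ {t m} e → t < m → xIndex t e < 2 * m
xIndex-bound {t} {m} e t<m =
  subst (xIndex t e <_) (cong (m +_) (sym (+-identityʳ m))) (≤-trans (s≤s (xIndex-≤ t e)) (double-< t<m))

toVert : ∀ {m} (a : Slotted) → slot a < m → Vert m
toVert (sx t e) t<m = x (fromℕ< (xIndex-bound e t<m))
toVert (sy t)   t<m = y (fromℕ< t<m)

unbound-toVert : ∀ {m} a (a<m : slot a < m) → unbound (toVert a a<m) ≡ toVert∞ a
unbound-toVert (sx t e) t<m = cong x∞ (Fin.toℕ-fromℕ< (xIndex-bound e t<m))
unbound-toVert (sy t)   t<m = cong y∞ (Fin.toℕ-fromℕ< t<m)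

arc : Bool → Bool → Slotted → Slotted → Bool
arc I₁ d a b = M∞ I₁ d (not d) (toVert∞ a) (toVert∞ b)

-- For d = true the top chain consists of x's and the bottom chain of y's; the matched top vertex
-- of slot t is x_{2t+1}, the only x that loses to y_{t+1}.  For d = false the roles of x and y
-- are exchanged, and the matched bottom vertex is x_{2t+2}, the only x that beats y_{t+1}.
topVertex : Bool → ℕ → Bool → Slotted
topVertex true  t matched = sx t (not matched)
topVertex false t _       = sy t

bottomVertex : Bool → ℕ → Bool → Slotted
bottomVertex true  t _       = sy t
bottomVertex false t matched = sx t matched

-- Whether, inside the top (resp. bottom) chain, the vertex of an earlier slot beats a later one.
topForward : Bool → Bool → Bool
topForward I₁ true  = true
topForward I₁ false = I₁

bottomForward : Bool → Bool → Bool
bottomForward I₁ true  = I₁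
bottomForward I₁ false = true

xy-apart : ∀ d {t s} e → t ≢ s → xy d (not d) (suc (xIndex t e)) (suc s) ≡ d
xy-apart d {t} {s} e t≢s with <-cmp t s
... | tri< t<s _ _ = xy-earlier d (not d) e t<s
... | tri≈ _ t≡s _ = ⊥-elim (t≢s t≡s)
... | tri> _ _ s<t = trans (xy-later d (not d) e s<t) (not-involutive d)

module _ (I₁ : Bool) where

  x-chain : ∀ d {t t'} e e' → t < t' → Arc (arc I₁ d) true (sx t e) (sx t' e')
  x-chain d e e' t<t' = <⇒<ᵇ-true (s≤s (xIndex-< e e' t<t'))
                      , ≤⇒<ᵇ-false (<⇒≤ (s≤s (xIndex-< e e' t<t')))

  y-chain : ∀ d {t t'} → t < t' → Arc (arc I₁ d) I₁ (sy t) (sy t')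
  y-chain d t<t' rewrite <⇒<ᵇ-true (s≤s t<t') | ≤⇒<ᵇ-false (<⇒≤ (s≤s t<t')) = refl , refl

  top-chain : ∀ d {t t'} p p' → t < t' →
    Arc (arc I₁ d) (topForward I₁ d) (topVertex d t p) (topVertex d t' p')
  top-chain true  p p' = x-chain true (not p) (not p')
  top-chain false p p' = y-chain false

  bottom-chain : ∀ d {t t'} q q' → t < t' →
    Arc (arc I₁ d) (bottomForward I₁ d) (bottomVertex d t q) (bottomVertex d t' q')
  bottom-chain true  q q' = y-chain true
  bottom-chain false q q' = x-chain false q q'

  top-bottom : ∀ d {t t'} p q → t ≢ t' → Arc (arc I₁ d) true (topVertex d t p) (bottomVertex d t' q)
  top-bottom true  p q t≢t' rewrite xy-apart true (not p) t≢t' = refl , refl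
  top-bottom false p q t≢t' rewrite xy-apart false q (t≢t' ∘ sym) = refl , refl

  matched-pair : ∀ d t → Arc (arc I₁ d) false (topVertex d t true) (bottomVertex d t true)
  matched-pair true  t rewrite xy-same true false t false = refl , refl
  matched-pair false t rewrite xy-same false true t true = refl , refl

-- Slot words and the tournaments they induce

-- A slot word lists, slot by slot, which of the top and bottom vertex of the slot are used.
data Slot : Set where
  topOnly bottomOnly matched : Slot

tops : Bool → ℕ → List Slot → List Slotted
tops d t []                = []
tops d t (topOnly ∷ w)    = topVertex d t false ∷ tops d (suc t) w
tops d t (bottomOnly ∷ w) = tops d (suc t) w
tops d t (matched ∷ w)    = topVertex d t true ∷ tops d (suc t) w

bottoms : Bool → ℕ → List Slot → List Slotted
bottoms d t []                = []
bottoms d t (topOnly ∷ w)    = bottoms d (suc t) w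
bottoms d t (bottomOnly ∷ w) = bottomVertex d t false ∷ bottoms d (suc t) w
bottoms d t (matched ∷ w)    = bottomVertex d t true ∷ bottoms d (suc t) w

topFlags : List Slot → List Bool
topFlags []                = []
topFlags (topOnly ∷ w)    = false ∷ topFlags w
topFlags (bottomOnly ∷ w) = topFlags w
topFlags (matched ∷ w)    = true ∷ topFlags w

bottomFlags : List Slot → List Bool
bottomFlags []                = []
bottomFlags (topOnly ∷ w)    = bottomFlags w
bottomFlags (bottomOnly ∷ w) = false ∷ bottomFlags w
bottomFlags (matched ∷ w)    = true ∷ bottomFlags w

length-tops : ∀ d t w → length (tops d t w) ≡ length (topFlags w)
length-tops d t []                = refl
length-tops d t (topOnly ∷ w)    = cong suc (length-tops d (suc t) w)
length-tops d t (bottomOnly ∷ w) = length-tops d (suc t) w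
length-tops d t (matched ∷ w)    = cong suc (length-tops d (suc t) w)

length-bottoms : ∀ d t w → length (bottoms d t w) ≡ length (bottomFlags w)
length-bottoms d t []                = refl
length-bottoms d t (topOnly ∷ w)    = length-bottoms d (suc t) w
length-bottoms d t (bottomOnly ∷ w) = cong suc (length-bottoms d (suc t) w)
length-bottoms d t (matched ∷ w)    = cong suc (length-bottoms d (suc t) w)

From : (ℕ → Bool → Slotted) → ℕ → Slotted → Set
From vertex t a = Σ ℕ λ s → Σ Bool λ p → t ≤ s × a ≡ vertex s p

From-weaken : ∀ {vertex t} → All (From vertex (suc t)) ⊆ All (From vertex t)
From-weaken = All.map λ (s , p , t<s , eq) → s , p , ≤-trans (n≤1+n _) t<s , eq

tops-from : ∀ d t w → All (From (topVertex d) t) (tops d t w)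
tops-from d t []                = []
tops-from d t (topOnly ∷ w)    = (t , false , ≤-refl , refl) ∷ From-weaken (tops-from d (suc t) w)
tops-from d t (bottomOnly ∷ w) = From-weaken (tops-from d (suc t) w)
tops-from d t (matched ∷ w)    = (t , true , ≤-refl , refl) ∷ From-weaken (tops-from d (suc t) w)

bottoms-from : ∀ d t w → All (From (bottomVertex d) t) (bottoms d t w)
bottoms-from d t []                = []
bottoms-from d t (topOnly ∷ w)    = From-weaken (bottoms-from d (suc t) w)
bottoms-from d t (bottomOnly ∷ w) = (t , false , ≤-refl , refl) ∷ From-weaken (bottoms-from d (suc t) w)
bottoms-from d t (matched ∷ w)    = (t , true , ≤-refl , refl) ∷ From-weaken (bottoms-from d (suc t) w)

topFlags-bounded : ∀ d t w → All (λ p → boolToℕ p ≤ length (bottoms d t w)) (topFlags w)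
topFlags-bounded d t []                = []
topFlags-bounded d t (topOnly ∷ w)    = z≤n ∷ topFlags-bounded d (suc t) w
topFlags-bounded d t (bottomOnly ∷ w) = All.map m≤n⇒m≤1+n (topFlags-bounded d (suc t) w)
topFlags-bounded d t (matched ∷ w)    = s≤s z≤n ∷ All.map m≤n⇒m≤1+n (topFlags-bounded d (suc t) w)

slot-topVertex : ∀ d t p → slot (topVertex d t p) ≡ t
slot-topVertex true  t p = refl
slot-topVertex false t p = refl

slot-bottomVertex : ∀ d t q → slot (bottomVertex d t q) ≡ t
slot-bottomVertex true  t q = refl
slot-bottomVertex false t q = refl

private
  first-slot : ∀ {t n} a → slot a ≡ t → slot a < t + suc n
  first-slot {t} a refl = m<m+n t z<s

  later-slots : ∀ {t n L} → All (λ a → slot a < suc t + n) L → All (λ a → slot a < t + suc n) L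
  later-slots {t} {n} = All.map λ {a} → subst (slot a <_) (sym (+-suc t n))

tops-bounded : ∀ d t w → All (λ a → slot a < t + length w) (tops d t w)
tops-bounded d t []                = []
tops-bounded d t (topOnly ∷ w)    =
  first-slot (topVertex d t false) (slot-topVertex d t false) ∷ later-slots (tops-bounded d (suc t) w)
tops-bounded d t (bottomOnly ∷ w) = later-slots (tops-bounded d (suc t) w)
tops-bounded d t (matched ∷ w)    =
  first-slot (topVertex d t true) (slot-topVertex d t true) ∷ later-slots (tops-bounded d (suc t) w)

bottoms-bounded : ∀ d t w → All (λ a → slot a < t + length w) (bottoms d t w)
bottoms-bounded d t []                = []
bottoms-bounded d t (topOnly ∷ w)    = later-slots (bottoms-bounded d (suc t) w)
bottoms-bounded d t (bottomOnly ∷ w) =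
  first-slot (bottomVertex d t false) (slot-bottomVertex d t false)
  ∷ later-slots (bottoms-bounded d (suc t) w)
bottoms-bounded d t (matched ∷ w)    =
  first-slot (bottomVertex d t true) (slot-bottomVertex d t true)
  ∷ later-slots (bottoms-bounded d (suc t) w)

top≢bottom : ∀ d {s s'} p q → toVert∞ (topVertex d s p) ≢ toVert∞ (bottomVertex d s' q)
top≢bottom true  p q ()
top≢bottom false p q ()

Arc⇒≢ : ∀ I₁ d {τ a b} → Arc (arc I₁ d) τ a b → toVert∞ a ≢ toVert∞ b
Arc⇒≢ I₁ d (ab≡τ , ba≡¬τ) eq =
  not-¬ refl (trans (sym ab≡τ) (trans (cong₂ (M∞ I₁ d (not d)) eq (sym eq)) ba≡¬τ))

module SlotWord (I₁ d : Bool) where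
  open Scores (arc I₁ d)
  open ≡-Reasoning

  tops-chain : ∀ t w → AllPairs (Arc (arc I₁ d) (topForward I₁ d)) (tops d t w)
  tops-chain t []                = []
  tops-chain t (topOnly ∷ w)    = All.map (λ { (s , p , t<s , refl) → top-chain I₁ d false p t<s })
                                    (tops-from d (suc t) w) ∷ tops-chain (suc t) w
  tops-chain t (bottomOnly ∷ w) = tops-chain (suc t) w
  tops-chain t (matched ∷ w)    = All.map (λ { (s , p , t<s , refl) → top-chain I₁ d true p t<s })
                                    (tops-from d (suc t) w) ∷ tops-chain (suc t) w

  bottoms-chain : ∀ t w → AllPairs (Arc (arc I₁ d) (bottomForward I₁ d)) (bottoms d t w)
  bottoms-chain t []                = []
  bottoms-chain t (topOnly ∷ w)    = bottoms-chain (suc t) w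
  bottoms-chain t (bottomOnly ∷ w) = All.map (λ { (s , q , t<s , refl) → bottom-chain I₁ d false q t<s })
                                       (bottoms-from d (suc t) w) ∷ bottoms-chain (suc t) w
  bottoms-chain t (matched ∷ w)    = All.map (λ { (s , q , t<s , refl) → bottom-chain I₁ d true q t<s })
                                       (bottoms-from d (suc t) w) ∷ bottoms-chain (suc t) w

  top-beats-later-bottoms : ∀ t p w → All (Arc (arc I₁ d) true (topVertex d t p)) (bottoms d (suc t) w)
  top-beats-later-bottoms t p w =
    All.map (λ { (s , q , t<s , refl) → top-bottom I₁ d p q (<⇒≢ t<s) }) (bottoms-from d (suc t) w)

  later-tops-beat-bottom : ∀ t q w →
    All (λ a → Arc (arc I₁ d) true a (bottomVertex d t q)) (tops d (suc t) w)
  later-tops-beat-bottom t q w =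
    All.map (λ { (s , p , t<s , refl) → top-bottom I₁ d p q (>⇒≢ t<s) }) (tops-from d (suc t) w)

  tops-vs-bottoms : ∀ t w → map (λ a → scoreIn a (bottoms d t w)) (tops d t w)
                          ≡ map (λ p → length (bottoms d t w) ∸ boolToℕ p) (topFlags w)
  tops-vs-new-bottom : ∀ t q w →
    map (λ a → scoreIn a (bottomVertex d t q ∷ bottoms d (suc t) w)) (tops d (suc t) w)
      ≡ map (λ p → suc (length (bottoms d (suc t) w)) ∸ boolToℕ p) (topFlags w)

  tops-vs-bottoms t [] = refl
  tops-vs-bottoms t (topOnly ∷ w) = cong₂ _∷_
    (scoreIn-all (topVertex d t false) _ (All.map proj₁ (top-beats-later-bottoms t false w)))
    (tops-vs-bottoms (suc t) w)
  tops-vs-bottoms t (bottomOnly ∷ w) = tops-vs-new-bottom t false w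
  tops-vs-bottoms t (matched ∷ w) = cong₂ _∷_
    (cong₂ _+_ (cong boolToℕ (proj₁ (matched-pair I₁ d t)))
               (scoreIn-all (topVertex d t true) _ (All.map proj₁ (top-beats-later-bottoms t true w))))
    (tops-vs-new-bottom t true w)

  tops-vs-new-bottom t q w = let B = bottoms d (suc t) w in begin
      map (λ a → scoreIn a (bottomVertex d t q ∷ B)) (tops d (suc t) w)
    ≡⟨ scores-∷ true _ B (All.map proj₁ (later-tops-beat-bottom t q w)) ⟩
      map (suc ∘ λ a → scoreIn a B) (tops d (suc t) w)
    ≡⟨ map-∘ (tops d (suc t) w) ⟩
      map suc (map (λ a → scoreIn a B) (tops d (suc t) w))
    ≡⟨ cong (map suc) (tops-vs-bottoms (suc t) w) ⟩
      map suc (map (λ p → length B ∸ boolToℕ p) (topFlags w))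
    ≡⟨ map-∘ (topFlags w) ⟨
      map (λ p → suc (length B ∸ boolToℕ p)) (topFlags w)
    ≡⟨ map-cong-local (All.map (sym ∘ +-∸-assoc 1) (topFlags-bounded d (suc t) w)) ⟩
      map (λ p → suc (length B) ∸ boolToℕ p) (topFlags w)
    ∎

  bottoms-vs-tops : ∀ t w →
    map (λ b → scoreIn b (tops d t w)) (bottoms d t w) ≡ map boolToℕ (bottomFlags w)
  bottoms-vs-tops t [] = refl
  bottoms-vs-tops t (topOnly ∷ w) =
    trans (scores-∷ false (topVertex d t false) (tops d (suc t) w)
                    (All.map proj₂ (top-beats-later-bottoms t false w)))
          (bottoms-vs-tops (suc t) w)
  bottoms-vs-tops t (bottomOnly ∷ w) = cong₂ _∷_
    (scoreIn-none (bottomVertex d t false) _ (All.map proj₂ (later-tops-beat-bottom t false w)))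
    (bottoms-vs-tops (suc t) w)
  bottoms-vs-tops t (matched ∷ w) = cong₂ _∷_
    (cong₂ _+_ (cong boolToℕ (proj₂ (matched-pair I₁ d t)))
               (scoreIn-none (bottomVertex d t true) _ (All.map proj₂ (later-tops-beat-bottom t true w))))
    (trans (scores-∷ false (topVertex d t true) (tops d (suc t) w)
                     (All.map proj₂ (top-beats-later-bottoms t true w)))
           (bottoms-vs-tops (suc t) w))

trues : List Bool → ℕ
trues u = sum (map boolToℕ u)

trues-orient : ∀ τ u → trues (orient τ u) ≡ trues u
trues-orient τ u = trans (cong sum (map-orient τ boolToℕ u)) (sum-orient τ _)

-- Interleaves top flags u and bottom flags v, matching the k-th matched entries of u and v.
-- The clauses reached only when trues u ≢ trues v are arbitrary.
merge : List Bool → List Bool → List Slot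
merge (false ∷ u) v           = topOnly ∷ merge u v
merge (true ∷ u)  (false ∷ v) = bottomOnly ∷ merge (true ∷ u) v
merge (true ∷ u)  (true ∷ v)  = matched ∷ merge u v
merge (true ∷ u)  []          = topOnly ∷ merge u []
merge []          (_ ∷ v)     = bottomOnly ∷ merge [] v
merge []          []          = []

merge-flags : ∀ u v → trues u ≡ trues v → topFlags (merge u v) ≡ u × bottomFlags (merge u v) ≡ v
merge-flags []          []          eq = refl , refl
merge-flags []          (false ∷ v) eq = Product.map₂ (cong (false ∷_)) (merge-flags [] v eq)
merge-flags (false ∷ u) v           eq = Product.map₁ (cong (false ∷_)) (merge-flags u v eq)
merge-flags (true ∷ u)  (false ∷ v) eq = Product.map₂ (cong (false ∷_)) (merge-flags (true ∷ u) v eq)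
merge-flags (true ∷ u)  (true ∷ v)  eq =
  Product.map (cong (true ∷_)) (cong (true ∷_)) (merge-flags u v (suc-injective eq))

-- Scores, read from the top, of a chain with matching flags u above b further vertices, and of a chain
-- with matching flags v below the top chain.
topScores : List Bool → ℕ → List ℕ
topScores u b = zipWith _+_ (downFrom (length u)) (map (λ p → b ∸ boolToℕ p) u)

bottomScores : List Bool → List ℕ
bottomScores v = zipWith _+_ (map boolToℕ v) (downFrom (length v))

expectedScores : List Bool → List Bool → List ℕ
expectedScores u v = topScores u (length v) ++ bottomScores v

module Realisation (I₁ d : Bool) (u v : List Bool) (balanced : trues u ≡ trues v) where
  open Scores (arc I₁ d)
  open SlotWord I₁ d
  open ≡-Reasoning

  private
    τ⊤ = topForward I₁ d
    τ⊥ = bottomForward I₁ d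

  word : List Slot
  word = merge (orient τ⊤ u) (orient τ⊥ v)

  private
    flags = merge-flags (orient τ⊤ u) (orient τ⊥ v)
      (trans (trues-orient τ⊤ u) (trans balanced (sym (trues-orient τ⊥ v))))

    T = tops d 0 word
    B = bottoms d 0 word

  topChain bottomChain vertices : List Slotted
  topChain    = orient τ⊤ T
  bottomChain = orient τ⊥ B
  vertices    = topChain ++ bottomChain

  length-B : length B ≡ length v
  length-B = begin
    length B                     ≡⟨ length-bottoms d 0 word ⟩
    length (bottomFlags word)    ≡⟨ cong length (proj₂ flags) ⟩
    length (orient τ⊥ v)         ≡⟨ length-orient τ⊥ v ⟩
    length v                     ∎

  length-topChain : length topChain ≡ length u
  length-topChain = begin
    length topChain              ≡⟨ length-orient τ⊤ T ⟩
    length T                     ≡⟨ length-tops d 0 word ⟩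
    length (topFlags word)       ≡⟨ cong length (proj₁ flags) ⟩
    length (orient τ⊤ u)         ≡⟨ length-orient τ⊤ u ⟩
    length u                     ∎

  length-bottomChain : length bottomChain ≡ length v
  length-bottomChain = trans (length-orient τ⊥ B) length-B

  length-vertices : length vertices ≡ length u + length v
  length-vertices = trans (length-++ topChain) (cong₂ _+_ length-topChain length-bottomChain)

  arc-irrefl : ∀ a → arc I₁ d a a ≡ false
  arc-irrefl a = M∞-irrefl I₁ d (not d) (toVert∞ a)

  topChain-transitive : AllPairs (Arc (arc I₁ d) true) topChain
  topChain-transitive = AllPairs-orient τ⊤ (tops-chain 0 word)

  bottomChain-transitive : AllPairs (Arc (arc I₁ d) true) bottomChain
  bottomChain-transitive = AllPairs-orient τ⊥ (bottoms-chain 0 word)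

  topChain-vs-bottomChain :
    map (λ a → scoreIn a bottomChain) topChain ≡ map (λ p → length v ∸ boolToℕ p) u
  topChain-vs-bottomChain = begin
      map (λ a → scoreIn a bottomChain) topChain
    ≡⟨ scores-orient τ⊤ τ⊥ T B ⟩
      orient τ⊤ (map (λ a → scoreIn a B) T)
    ≡⟨ cong (orient τ⊤) (tops-vs-bottoms 0 word) ⟩
      orient τ⊤ (map (λ p → length B ∸ boolToℕ p) (topFlags word))
    ≡⟨ map-orient τ⊤ _ (topFlags word) ⟨
      map (λ p → length B ∸ boolToℕ p) (orient τ⊤ (topFlags word))
    ≡⟨ cong₂ (λ n fl → map (λ p → n ∸ boolToℕ p) (orient τ⊤ fl)) length-B (proj₁ flags) ⟩
      map (λ p → length v ∸ boolToℕ p) (orient τ⊤ (orient τ⊤ u))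
    ≡⟨ cong (map _) (orient-involutive τ⊤ u) ⟩
      map (λ p → length v ∸ boolToℕ p) u
    ∎

  bottomChain-vs-topChain : map (λ b → scoreIn b topChain) bottomChain ≡ map boolToℕ v
  bottomChain-vs-topChain = begin
      map (λ b → scoreIn b topChain) bottomChain
    ≡⟨ scores-orient τ⊥ τ⊤ B T ⟩
      orient τ⊥ (map (λ b → scoreIn b T) B)
    ≡⟨ cong (orient τ⊥) (bottoms-vs-tops 0 word) ⟩
      orient τ⊥ (map boolToℕ (bottomFlags word))
    ≡⟨ map-orient τ⊥ boolToℕ (bottomFlags word) ⟨
      map boolToℕ (orient τ⊥ (bottomFlags word))
    ≡⟨ cong (map boolToℕ ∘ orient τ⊥) (proj₂ flags) ⟩
      map boolToℕ (orient τ⊥ (orient τ⊥ v))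
    ≡⟨ cong (map boolToℕ) (orient-involutive τ⊥ v) ⟩
      map boolToℕ v
    ∎

  topChain-scores : map (λ a → scoreIn a topChain) topChain ≡ downFrom (length u)
  topChain-scores = trans (transitive-scores arc-irrefl topChain-transitive) (cong downFrom length-topChain)

  bottomChain-scores : map (λ b → scoreIn b bottomChain) bottomChain ≡ downFrom (length v)
  bottomChain-scores =
    trans (transitive-scores arc-irrefl bottomChain-transitive) (cong downFrom length-bottomChain)

  vertices-scores : map (λ a → scoreIn a vertices) vertices ≡ expectedScores u v
  vertices-scores = begin
      map (λ a → scoreIn a vertices) (topChain ++ bottomChain)
    ≡⟨ map-++ _ topChain bottomChain ⟩
      map (λ a → scoreIn a vertices) topChain ++ map (λ a → scoreIn a vertices) bottomChain
    ≡⟨ cong₂ _++_ (split topChain) (split bottomChain) ⟩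
      zipWith _+_ (against topChain topChain) (against topChain bottomChain) ++
      zipWith _+_ (against bottomChain topChain) (against bottomChain bottomChain)
    ≡⟨ cong₂ _++_ (cong₂ (zipWith _+_) topChain-scores topChain-vs-bottomChain)
                  (cong₂ (zipWith _+_) bottomChain-vs-topChain bottomChain-scores) ⟩
      expectedScores u v
    ∎
    where
    against : List Slotted → List Slotted → List ℕ
    against L L' = map (λ a → scoreIn a L') L

    split : ∀ L → map (λ a → scoreIn a vertices) L
                ≡ zipWith _+_ (against L topChain) (against L bottomChain)
    split L = trans (map-cong (λ a → scoreIn-++ a topChain bottomChain) L) (map-+ _ _ L)

  vertices-distinct : AllPairs (λ a b → toVert∞ a ≢ toVert∞ b) vertices
  vertices-distinct = AllPairsₚ.++⁺
    (AllPairs.map (Arc⇒≢ I₁ d) topChain-transitive)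
    (AllPairs.map (Arc⇒≢ I₁ d) bottomChain-transitive)
    (All.map (λ { (s , p , _ , refl) → All.map (λ { (s' , q , _ , refl) → top≢bottom d p q })
                                               (All-orient τ⊥ (bottoms-from d 0 word)) })
             (All-orient τ⊤ (tops-from d 0 word)))

  vertices-bounded : All (λ a → slot a < length word) vertices
  vertices-bounded =
    All-++⁺ (All-orient τ⊤ (tops-bounded d 0 word)) (All-orient τ⊥ (bottoms-bounded d 0 word))

-- Codes with pairwise different score sequences

length-∷ʳ : ∀ {A : Set} (v : List A) c → length (v ∷ʳ c) ≡ suc (length v)
length-∷ʳ v c = trans (length-++ v) (+-comm (length v) 1)

trues≤length : ∀ u → trues u ≤ length u
trues≤length []          = z≤n
trues≤length (false ∷ u) = m≤n⇒m≤1+n (trues≤length u)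
trues≤length (true ∷ u)  = s≤s (trues≤length u)

trues-∷ʳ : ∀ v c → trues (v ∷ʳ c) ≡ trues v + boolToℕ c
trues-∷ʳ v c = begin
  sum (map boolToℕ (v ++ [ c ]))          ≡⟨ cong sum (map-++ boolToℕ v [ c ]) ⟩
  sum (map boolToℕ v ++ [ boolToℕ c ])    ≡⟨ sum-++ (map boolToℕ v) _ ⟩
  trues v + (boolToℕ c + 0)               ≡⟨ cong (trues v +_) (+-identityʳ _) ⟩
  trues v + boolToℕ c                     ∎
  where open ≡-Reasoning

topScores-suc : ∀ u b → trues u ≤ b → topScores u (suc b) ≡ map suc (topScores u b)
topScores-suc []          b       _           = refl
topScores-suc (false ∷ u) b       tu≤b        = cong₂ _∷_ (+-suc (length u) b) (topScores-suc u b tu≤b)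
topScores-suc (true ∷ u)  (suc b) (s≤s tu≤b) =
  cong₂ _∷_ (+-suc (length u) b) (topScores-suc u (suc b) (m≤n⇒m≤1+n tu≤b))

bottomScores-∷ʳ : ∀ v c → bottomScores (v ∷ʳ c) ≡ map suc (bottomScores v) ∷ʳ boolToℕ c
bottomScores-∷ʳ []      c = cong [_] (+-identityʳ (boolToℕ c))
bottomScores-∷ʳ (p ∷ v) c = cong₂ _∷_
  (trans (cong (boolToℕ p +_) (length-∷ʳ v c)) (+-suc (boolToℕ p) (length v)))
  (bottomScores-∷ʳ v c)

expectedScores-∷ʳ : ∀ u v c → trues u ≤ length v →
  expectedScores u (v ∷ʳ c) ≡ map suc (expectedScores u v) ∷ʳ boolToℕ c
expectedScores-∷ʳ u v c tu≤v = begin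
    topScores u (length (v ∷ʳ c)) ++ bottomScores (v ∷ʳ c)
  ≡⟨ cong₂ _++_ (trans (cong (topScores u) (length-∷ʳ v c)) (topScores-suc u (length v) tu≤v))
                (bottomScores-∷ʳ v c) ⟩
    map suc (topScores u (length v)) ++ (map suc (bottomScores v) ∷ʳ boolToℕ c)
  ≡⟨ ++-assoc (map suc (topScores u (length v))) _ _ ⟨
    (map suc (topScores u (length v)) ++ map suc (bottomScores v)) ∷ʳ boolToℕ c
  ≡⟨ cong (_∷ʳ boolToℕ c) (map-++ suc (topScores u (length v)) (bottomScores v)) ⟨
    map suc (expectedScores u v) ∷ʳ boolToℕ c
  ∎
  where open ≡-Reasoning

Code : Set
Code = List Bool × List Bool

size : Code → ℕ
size (u , v) = length u + length v

scoresOf : Code → List ℕ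
scoresOf (u , v) = expectedScores u v

addTop addBottom addMatchedPair : Code → Code
addTop         (u , v) = false ∷ u , v
addBottom      (u , v) = u , v ∷ʳ false
addMatchedPair (u , v) = true ∷ u , v ∷ʳ true

record Admissible (n : ℕ) (κ : Code) : Set where
  field
    size≡    : size κ ≡ n
    balanced : trues (proj₁ κ) ≡ trues (proj₂ κ)
    sorted   : AllPairs _≥_ (scoresOf κ)
    bounded  : All (_< n) (scoresOf κ)

  tops≤bottoms : trues (proj₁ κ) ≤ length (proj₂ κ)
  tops≤bottoms = subst (_≤ length (proj₂ κ)) (sym balanced) (trues≤length (proj₂ κ))

open Admissible

size-∷ʳ : ∀ u v c → size (u , v ∷ʳ c) ≡ suc (size (u , v))
size-∷ʳ u v c = trans (cong (length u +_) (length-∷ʳ v c)) (+-suc (length u) (length v))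

scores-addBottom : ∀ {n} κ → Admissible n κ → scoresOf (addBottom κ) ≡ map suc (scoresOf κ) ∷ʳ 0
scores-addBottom (u , v) adm = expectedScores-∷ʳ u v false (tops≤bottoms adm)

scores-addMatchedPair : ∀ {n} κ → Admissible n κ →
  scoresOf (addMatchedPair κ) ≡ n ∷ (map suc (scoresOf κ) ∷ʳ 1)
scores-addMatchedPair (u , v) adm = cong₂ _∷_
  (trans (cong (λ l → length u + (l ∸ 1)) (length-∷ʳ v true)) (size≡ adm))
  (expectedScores-∷ʳ u v true (tops≤bottoms adm))

sorted-∷ʳ : ∀ {E c} → c ≤ 1 → AllPairs _≥_ E → AllPairs _≥_ (map suc E ∷ʳ c)
sorted-∷ʳ c≤1 sorted = AllPairsₚ.++⁺
  (AllPairsₚ.map⁺ (AllPairs.map s≤s sorted)) ([] ∷ [])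
  (All-map⁺ (All.tabulate (λ _ → ≤-trans c≤1 (s≤s z≤n) ∷ [])))

addTop-admissible : ∀ {n} κ → Admissible n κ → Admissible (suc n) (addTop κ)
addTop-admissible {n} κ adm = record
  { size≡    = cong suc (size≡ adm)
  ; balanced = balanced adm
  ; sorted   = subst (λ h → All (_≤ h) (scoresOf κ)) (sym (size≡ adm)) (All.map <⇒≤ (bounded adm))
               ∷ sorted adm
  ; bounded  = subst (_< suc n) (sym (size≡ adm)) ≤-refl ∷ All.map m<n⇒m<1+n (bounded adm)
  }

addBottom-admissible : ∀ {n} κ → Admissible n κ → Admissible (suc n) (addBottom κ)
addBottom-admissible {n} κ@(u , v) adm = record
  { size≡    = trans (size-∷ʳ u v false) (cong suc (size≡ adm))
  ; balanced = trans (balanced adm) (sym (trans (trues-∷ʳ v false) (+-identityʳ (trues v))))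
  ; sorted   = subst (AllPairs _≥_) (sym (scores-addBottom κ adm))
                 (sorted-∷ʳ z≤n (sorted adm))
  ; bounded  = subst (All (_< _)) (sym (scores-addBottom κ adm))
                 (All-++⁺ (All-map⁺ (All.map s≤s (bounded adm))) (z<s {n} ∷ []))
  }

addMatchedPair-admissible : ∀ {n} κ → Admissible (suc n) κ → Admissible (3 + n) (addMatchedPair κ)
addMatchedPair-admissible {n} κ@(u , v) adm = record
  { size≡    = cong suc (trans (size-∷ʳ u v true) (cong suc (size≡ adm)))
  ; balanced = trans (cong suc (balanced adm)) (sym (trans (trues-∷ʳ v true) (+-comm (trues v) 1)))
  ; sorted   = subst (AllPairs _≥_) (sym scores)
                 (All-++⁺ (All-map⁺ (bounded adm)) (s≤s z≤n ∷ [])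
                  ∷ sorted-∷ʳ ≤-refl (sorted adm))
  ; bounded  = subst (All (_< 3 + n)) (sym scores)
                 (m<n⇒m<1+n (n<1+n (suc n))
                  ∷ All-++⁺ (All-map⁺ (All.map (m<n⇒m<1+n ∘ s≤s) (bounded adm))) (s≤s (s≤s z≤n) ∷ []))
  }
  where scores = scores-addMatchedPair κ adm

-- matchedCodes n are the codes of codes n whose topmost vertex is matched.
codes matchedCodes : ℕ → List Code
codes zero    = [ [] , [] ]
codes (suc n) = map addTop (codes n) ++ matchedCodes (suc n)
matchedCodes (suc (suc (suc n))) =
  map addMatchedPair (codes (suc n)) ++ map addBottom (matchedCodes (suc (suc n)))
matchedCodes _ = []

length-++-doubles : ∀ {A : Set} n (L L' : List A) →
  length L ≡ 2 ^ n → length L' ≡ 2 ^ n → length (L ++ L') ≡ 2 ^ suc n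
length-++-doubles n L L' eq eq' = begin
  length (L ++ L')       ≡⟨ length-++ L ⟩
  length L + length L'   ≡⟨ cong₂ _+_ eq eq' ⟩
  2 ^ n + 2 ^ n          ≡⟨ cong (2 ^ n +_) (+-identityʳ (2 ^ n)) ⟨
  2 ^ suc n              ∎
  where open ≡-Reasoning

length-codes⁺ : ∀ n → length (codes (2 + n)) ≡ 2 ^ n × length (matchedCodes (3 + n)) ≡ 2 ^ n
length-codes⁺ zero    = refl , refl
length-codes⁺ (suc n) =
  length-++-doubles n (map addTop (codes (2 + n))) (matchedCodes (3 + n))
    (trans (length-map addTop (codes (2 + n))) codes≡) matched≡ ,
  length-++-doubles n (map addMatchedPair (codes (2 + n))) (map addBottom (matchedCodes (3 + n)))
    (trans (length-map addMatchedPair (codes (2 + n))) codes≡)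
    (trans (length-map addBottom (matchedCodes (3 + n))) matched≡)
  where
  codes≡   = proj₁ (length-codes⁺ n)
  matched≡ = proj₂ (length-codes⁺ n)

length-codes : ∀ n → length (codes n) ≡ 2 ^ (n ∸ 2)
length-codes zero                = refl
length-codes (suc zero)          = refl
length-codes (suc (suc n))       = proj₁ (length-codes⁺ n)

codes-admissible        : ∀ n → All (Admissible n) (codes n)
matchedCodes-admissible : ∀ n → All (Admissible n) (matchedCodes n)

codes-admissible zero    = record { size≡ = refl ; balanced = refl ; sorted = [] ; bounded = [] } ∷ []
codes-admissible (suc n) = All-++⁺
  (All-map⁺ (All.map (addTop-admissible _) (codes-admissible n))) (matchedCodes-admissible (suc n))

matchedCodes-admissible (suc (suc (suc n))) = All-++⁺
  (All-map⁺ (All.map (addMatchedPair-admissible _) (codes-admissible (suc n))))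
  (All-map⁺ (All.map (addBottom-admissible _) (matchedCodes-admissible (suc (suc n)))))
matchedCodes-admissible zero             = []
matchedCodes-admissible (suc zero)       = []
matchedCodes-admissible (suc (suc zero)) = []

addMatchedPair-injective : ∀ {n κ κ'} → Admissible n κ → Admissible n κ' →
  scoresOf (addMatchedPair κ) ≡ scoresOf (addMatchedPair κ') → scoresOf κ ≡ scoresOf κ'
addMatchedPair-injective {κ = κ} {κ'} adm adm' eq =
  map-injective suc-injective (∷ʳ-injectiveˡ (map suc (scoresOf κ)) (map suc (scoresOf κ'))
    (∷-injectiveʳ (trans (sym (scores-addMatchedPair κ adm)) (trans eq (scores-addMatchedPair κ' adm')))))

addBottom-injective : ∀ {n κ κ'} → Admissible n κ → Admissible n κ' →
  scoresOf (addBottom κ) ≡ scoresOf (addBottom κ') → scoresOf κ ≡ scoresOf κ'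
addBottom-injective {κ = κ} {κ'} adm adm' eq =
  map-injective suc-injective (∷ʳ-injectiveˡ (map suc (scoresOf κ)) (map suc (scoresOf κ'))
    (trans (sym (scores-addBottom κ adm)) (trans eq (scores-addBottom κ' adm'))))

-- The lowest score is 1 after adding a matched pair and 0 after adding a bottom vertex.
addMatchedPair≢addBottom : ∀ {n n' κ κ'} → Admissible n κ → Admissible n' κ' →
  scoresOf (addMatchedPair κ) ≢ scoresOf (addBottom κ')
addMatchedPair≢addBottom {n} {κ = κ} {κ'} adm adm' eq with
  ∷ʳ-injectiveʳ (n ∷ map suc (scoresOf κ)) (map suc (scoresOf κ'))
    (trans (sym (scores-addMatchedPair κ adm)) (trans eq (scores-addBottom κ' adm')))
... | ()

matchedCodes-head : ∀ n → All (λ κ → head (scoresOf κ) ≡ just (suc n)) (matchedCodes (3 + n))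
matchedCodes-head n = All-++⁺
  (All-map⁺ (All.map (λ {κ} adm → cong head (scores-addMatchedPair κ adm)) (codes-admissible (suc n))))
  (All-map⁺ (lowered n))
  where
  lowered : ∀ n → All (λ κ → head (scoresOf (addBottom κ)) ≡ just (suc n)) (matchedCodes (2 + n))
  lowered zero    = []
  lowered (suc k) =
    All.map (λ {κ} (adm , hd) → trans (cong head (scores-addBottom κ adm)) (head-lowered _ hd))
            (All.zip (matchedCodes-admissible (3 + k) , matchedCodes-head k))
    where
    head-lowered : ∀ E {h} → head E ≡ just h → head (map suc E ∷ʳ 0) ≡ just (suc h)
    head-lowered (e ∷ E) eq = cong (Maybe.map suc) eq

Distinguished : Code → Code → Set
Distinguished κ κ' = scoresOf κ ≢ scoresOf κ'

codes-distinguished        : ∀ n → AllPairs Distinguished (codes n)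
matchedCodes-distinguished : ∀ n → AllPairs Distinguished (matchedCodes n)

codes-distinguished zero    = [] ∷ []
codes-distinguished (suc n) = AllPairsₚ.++⁺
  (AllPairsₚ.map⁺ (AllPairs.map (λ ≢ → ≢ ∘ ∷-injectiveʳ) (codes-distinguished n)))
  (matchedCodes-distinguished (suc n))
  (All-map⁺ (topped-vs-matched n))
  where
  -- addTop κ has top score 2 + k, while every code of matchedCodes (3 + k) has top score 1 + k.
  topped-vs-matched : ∀ n → All (λ κ → All (Distinguished (addTop κ)) (matchedCodes (suc n))) (codes n)
  topped-vs-matched (suc (suc k)) = All.map
    (λ adm → All.map (λ hd eq → >⇒≢ (n<1+n (suc k)) (just-injective
                                 (trans (cong just (sym (size≡ adm))) (trans (cong head eq) hd))))
                     (matchedCodes-head k))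
    (codes-admissible (2 + k))
  topped-vs-matched zero       = All.tabulate (λ _ → [])
  topped-vs-matched (suc zero) = All.tabulate (λ _ → [])

matchedCodes-distinguished (suc (suc (suc n))) = AllPairsₚ.++⁺
  (AllPairsₚ.map⁺ (AllPairs-mapWith (λ adm adm' ≢ → ≢ ∘ addMatchedPair-injective adm adm')
                                    (codes-admissible (suc n)) (codes-distinguished (suc n))))
  (AllPairsₚ.map⁺ (AllPairs-mapWith (λ adm adm' ≢ → ≢ ∘ addBottom-injective adm adm')
                                    (matchedCodes-admissible (2 + n))
                                    (matchedCodes-distinguished (suc (suc n)))))
  (All-map⁺ (All.map (λ adm → All-map⁺ (All.map (addMatchedPair≢addBottom adm)
                                               (matchedCodes-admissible (2 + n))))
                     (codes-admissible (suc n))))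
matchedCodes-distinguished zero             = []
matchedCodes-distinguished (suc zero)       = []
matchedCodes-distinguished (suc (suc zero)) = []

module Realised (I₁ d : Bool) {n} (κ : Code) (adm : Admissible n κ) where
  open Realisation I₁ d (proj₁ κ) (proj₂ κ) (balanced adm)
  open Scores (arc I₁ d) using (scoreIn)
  open ≡-Reasoning

  private
    m = length word
    n-vertices : length vertices ≡ n
    n-vertices = trans length-vertices (size≡ adm)
    n-vertex-scores : length (map (λ a → scoreIn a vertices) vertices) ≡ n
    n-vertex-scores = trans (length-map _ vertices) n-vertices
    n-scores : length (scoresOf κ) ≡ n
    n-scores = trans (cong length (sym vertices-scores)) n-vertex-scores

  vertex : Fin n → Slotted
  vertex = at vertices n-vertices

  embedding : Fin n → Vert m
  embedding i = toVert (vertex i) (at-All n-vertices vertices-bounded i)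

  unbound-embedding : ∀ i → unbound (embedding i) ≡ toVert∞ (vertex i)
  unbound-embedding i = unbound-toVert (vertex i) (at-All n-vertices vertices-bounded i)

  embedding-injective : Injective _≡_ _≡_ embedding
  embedding-injective {i} {j} eq with <-cmp (toℕ i) (toℕ j)
  ... | tri< i<j _ _ = ⊥-elim (at-AllPairs n-vertices vertices-distinct i<j same)
    where same = trans (sym (unbound-embedding i)) (trans (cong unbound eq) (unbound-embedding j))
  ... | tri≈ _ i≡j _ = Fin.toℕ-injective i≡j
  ... | tri> _ _ j<i = ⊥-elim (at-AllPairs n-vertices vertices-distinct j<i same)
    where same = trans (sym (unbound-embedding j)) (trans (cong unbound (sym eq)) (unbound-embedding i))

  tournament : Tournament n
  tournament = record
    { adj    = λ i j → M I₁ d (not d) m (embedding i) (embedding j)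
    ; irrefl = λ i → trans (M≡M∞ I₁ d (not d) m (embedding i) (embedding i))
                            (M∞-irrefl I₁ d (not d) (unbound (embedding i)))
    ; tourn  = λ i j i≢j → trans (M≡M∞ I₁ d (not d) m (embedding i) (embedding j))
        (trans (M∞-flip I₁ d (not d) _ _ (i≢j ∘ embedding-injective ∘ unbound-injective))
               (cong not (sym (M≡M∞ I₁ d (not d) m (embedding j) (embedding i)))))
    }

  embeds : Embeds I₁ d (not d) tournament
  embeds = m , embedding , embedding-injective , λ _ _ → refl

  score-tournament : ∀ i → score tournament i ≡ at (scoresOf κ) n-scores i
  score-tournament i = begin
      ∑[ j < n ] boolToℕ (M I₁ d (not d) m (embedding i) (embedding j))
    ≡⟨ sum-cong-≗ (λ j → cong boolToℕ (trans (M≡M∞ I₁ d (not d) m (embedding i) (embedding j))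
                     (cong₂ (M∞ I₁ d (not d)) (unbound-embedding i) (unbound-embedding j)))) ⟩
      ∑[ j < n ] boolToℕ (arc I₁ d (vertex i) (vertex j))
    ≡⟨ sum-at vertices n-vertices _ ⟩
      scoreIn (vertex i) vertices
    ≡⟨ at-map (λ a → scoreIn a vertices) vertices n-vertices n-vertex-scores i ⟨
      at (map (λ a → scoreIn a vertices) vertices) n-vertex-scores i
    ≡⟨ at-cong vertices-scores i ⟩
      at (scoresOf κ) n-scores i
    ∎

  score-nonIncreasing : NonIncreasing (score tournament)
  score-nonIncreasing {i} {j} i≤j rewrite score-tournament i | score-tournament j
    with m≤n⇒m<n∨m≡n i≤j
  ... | inj₁ i<j = at-AllPairs n-scores (sorted adm) i<j
  ... | inj₂ i≡j rewrite Fin.toℕ-injective i≡j = ≤-refl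

family : ∀ I₁ d n → L≥ I₁ d (not d) n (2 ^ (n ∸ 2))
family I₁ d n = tournamentOf , embeds , non-isomorphic
  where
  code : Fin (2 ^ (n ∸ 2)) → Code
  code = at (codes n) (length-codes n)

  admissible : ∀ k → Admissible n (code k)
  admissible = at-All (length-codes n) (codes-admissible n)

  open module R k = Realised I₁ d (code k) (admissible k) using (embeds)

  tournamentOf : Fin (2 ^ (n ∸ 2)) → Tournament n
  tournamentOf k = R.tournament k

  distinguished : ∀ {k l} → k ≢ l → Distinguished (code k) (code l)
  distinguished {k} {l} k≢l with <-cmp (toℕ k) (toℕ l)
  ... | tri< k<l _ _ = at-AllPairs (length-codes n) (codes-distinguished n) k<l
  ... | tri≈ _ k≡l _ = ⊥-elim (k≢l (Fin.toℕ-injective k≡l))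
  ... | tri> _ _ l<k = at-AllPairs (length-codes n) (codes-distinguished n) l<k ∘ sym

  non-isomorphic : ∀ k l → k ≢ l → ¬ Iso (tournamentOf k) (tournamentOf l)
  non-isomorphic k l k≢l iso = distinguished k≢l (at-ext _ _ _ _ λ i → begin
      at (scoresOf (code k)) _ i  ≡⟨ R.score-tournament k i ⟨
      score (tournamentOf k) i    ≡⟨ iso⇒equal-scores {S = tournamentOf k} {tournamentOf l} iso
                                       (R.score-nonIncreasing k) (R.score-nonIncreasing l) i ⟩
      score (tournamentOf l) i    ≡⟨ R.score-tournament l i ⟩
      at (scoresOf (code l)) _ i  ∎)
    where open ≡-Reasoning

lemma14 : (I₁ I₂ I₃ : Bool) → I₂ ≢ I₃ → (n : ℕ) → L≥ I₁ I₂ I₃ n (2 ^ (n ∸ 2))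
lemma14 I₁ false false I₂≢I₃ n = ⊥-elim (I₂≢I₃ refl)
lemma14 I₁ false true  I₂≢I₃ n = family I₁ false n
lemma14 I₁ true  false I₂≢I₃ n = family I₁ true n
lemma14 I₁ true  true  I₂≢I₃ n = ⊥-elim (I₂≢I₃ refl)
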